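{- Let $P=\{x\in\mathbb R^n: Ax=b,\ Bx\le d\}$ be an integral polyhedron whose constraint matrix $\binom{A}{B}$ is totally unimodular. Then all circuit walks in $P$ (with respect to the circuits $\mathcal C(A,B)$) are integral.
   Context: An integral polyhedron is one all of whose vertices have integer coordinates. A matrix is totally unimodular if every square submatrix has determinant in $\{0,1,-1\}$. The set of circuits $\mathcal C(A,B)$ consists of all $g\in\ker(A)\setminus\{0\}$ with coprime integer components such that the support of $Bg$ is inclusion-minimal among the supports of the vectors $Bx$, $x\in\ker(A)\setminus\{0\}$. For vertices $v^{(1)},v^{(2)}$ of $P$, a circuit walk is a sequence $v^{(1)}=y^{(0)},\dots,y^{(k)}=v^{(2)}$ such that for $i=0,\dots,k-1$: $y^{(i)}\in P$; $y^{(i+1)}=y^{(i)}+\alpha_i g^{(i)}$ for some $g^{(i)}\in\mathcal C(A,B)$ and $\alpha_i>0$; and $y^{(i)}+\alpha g^{(i)}\notin P$ for all $\alpha>\alpha_i$. The walk is integral if every $y^{(i)}$ is an integer vector.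
   Formalization: Stated over ℚ: b, d, all points of $P$ and the step lengths are rational, and vertices, circuit minimality and maximality of steps are tested against rational vectors and scalars only. -}

module Defs where

open import Data.Nat as ℕ using (ℕ; zero; suc)
open import Data.Integer as ℤ using (ℤ; +_; -[1+_])
open import Data.Rational as ℚ using (ℚ; 0ℚ; 1ℚ; _/_)
open import Data.Fin using (Fin; zero; suc; punchIn; inject₁; toℕ; fromℕ; splitAt)
open import Data.Product using (Σ; ∃; _×_; _,_)
open import Data.Sum using (_⊎_; inj₁; inj₂)
open import Relation.Binary.PropositionalEquality using (_≡_; _≢_)
open import Relation.Nullary using (¬_)
open import Data.Nat.Divisibility using (_∣_)
open import Function.Definitions using (Injective)

Vecℚ : ℕ → Set
Vecℚ n = Fin n → ℚ

Vecℤ : ℕ → Set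
Vecℤ n = Fin n → ℤ

Matℤ : ℕ → ℕ → Set
Matℤ m n = Fin m → Fin n → ℤ

sumℤ : (k : ℕ) → (Fin k → ℤ) → ℤ
sumℤ zero    f = + 0
sumℤ (suc k) f = f zero ℤ.+ sumℤ k (λ i → f (suc i))

sumℚ : (k : ℕ) → (Fin k → ℚ) → ℚ
sumℚ zero    f = 0ℚ
sumℚ (suc k) f = f zero ℚ.+ sumℚ k (λ i → f (suc i))

ℤ→ℚ : ℤ → ℚ
ℤ→ℚ z = z / 1

_·_ : ∀ {m n} → Matℤ m n → Vecℚ n → Vecℚ m
(M · x) i = sumℚ _ (λ j → ℤ→ℚ (M i j) ℚ.* x j)

toℚ : ∀ {n} → Vecℤ n → Vecℚ n
toℚ g j = ℤ→ℚ (g j)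

_+[_]_ : ∀ {n} → Vecℚ n → ℚ → Vecℚ n → Vecℚ n
(x +[ α ] g) j = x j ℚ.+ α ℚ.* g j

signℤ : ℕ → ℤ
signℤ zero          = + 1
signℤ (suc zero)    = -[1+ 0 ]
signℤ (suc (suc k)) = signℤ k

det : (k : ℕ) → Matℤ k k → ℤ
det zero    M = + 1
det (suc k) M = sumℤ (suc k) (λ j →
  signℤ (toℕ j) ℤ.* (M zero j ℤ.* det k (λ r c → M (suc r) (punchIn j c))))

subMatrix : ∀ {m n k} → Matℤ m n → (Fin k → Fin m) → (Fin k → Fin n) → Matℤ k k
subMatrix M r c i j = M (r i) (c j)

TotallyUnimodular : ∀ {m n} → Matℤ m n → Set
TotallyUnimodular {m} {n} M =
  ∀ (k : ℕ) (r : Fin k → Fin m) (c : Fin k → Fin n) →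
  Injective _≡_ _≡_ r → Injective _≡_ _≡_ c →
  let δ = det k (subMatrix M r c) in
  (δ ≡ + 0) ⊎ (δ ≡ + 1) ⊎ (δ ≡ -[1+ 0 ])

stack : ∀ {m p n} → Matℤ m n → Matℤ p n → Matℤ (m ℕ.+ p) n
stack {m} {p} A B i j with splitAt m i
... | inj₁ i' = A i' j
... | inj₂ i' = B i' j

InP : ∀ {m p n} → Matℤ m n → Vecℚ m → Matℤ p n → Vecℚ p → Vecℚ n → Set
InP A b B d x = (∀ i → (A · x) i ≡ b i) × (∀ i → (B · x) i ℚ.≤ d i)

IsVertex : ∀ {m p n} → Matℤ m n → Vecℚ m → Matℤ p n → Vecℚ p → Vecℚ n → Set
IsVertex {n = n} A b B d v =
  InP A b B d v ×
  (∀ (y z : Vecℚ n) (λ' : ℚ) → InP A b B d y → InP A b B d z →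
     0ℚ ℚ.< λ' → λ' ℚ.< 1ℚ →
     (∀ j → v j ≡ λ' ℚ.* y j ℚ.+ (1ℚ ℚ.- λ') ℚ.* z j) →
     ∀ j → y j ≡ z j)

IsIntegralVec : ∀ {n} → Vecℚ n → Set
IsIntegralVec x = ∀ j → ∃ λ (z : ℤ) → x j ≡ ℤ→ℚ z

IntegralPolyhedron : ∀ {m p n} → Matℤ m n → Vecℚ m → Matℤ p n → Vecℚ p → Set
IntegralPolyhedron {n = n} A b B d =
  ∀ (v : Vecℚ n) → IsVertex A b B d v → IsIntegralVec v

InKer : ∀ {m n} → Matℤ m n → Vecℚ n → Set
InKer A x = ∀ i → (A · x) i ≡ 0ℚ

NonZeroVec : ∀ {n} → Vecℚ n → Set
NonZeroVec x = ¬ (∀ j → x j ≡ 0ℚ)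

CoprimeComponents : ∀ {n} → Vecℤ n → Set
CoprimeComponents g = ∀ (e : ℕ) → (∀ j → e ∣ ℤ.∣ g j ∣) → e ≡ 1

SuppSubset : ∀ {p} → Vecℚ p → Vecℚ p → Set
SuppSubset u w = ∀ i → u i ≢ 0ℚ → w i ≢ 0ℚ

IsCircuit : ∀ {m p n} → Matℤ m n → Matℤ p n → Vecℤ n → Set
IsCircuit {n = n} A B g =
  InKer A (toℚ g) × NonZeroVec (toℚ g) × CoprimeComponents g ×
  (∀ (x : Vecℚ n) → InKer A x → NonZeroVec x →
     SuppSubset (B · x) (B · toℚ g) → SuppSubset (B · toℚ g) (B · x))

record CircuitWalk {m p n} (A : Matℤ m n) (b : Vecℚ m) (B : Matℤ p n) (d : Vecℚ p)
                   (v₁ v₂ : Vecℚ n) : Set where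
  field
    len  : ℕ
    y    : Fin (suc len) → Vecℚ n
    g    : Fin len → Vecℤ n
    α    : Fin len → ℚ
    start : y zero ≡ v₁
    end   : y (fromℕ len) ≡ v₂
    inP      : ∀ i → InP A b B d (y (inject₁ i))
    circuit  : ∀ i → IsCircuit A B (g i)
    positive : ∀ i → 0ℚ ℚ.< α i
    step     : ∀ i → y (suc i) ≡ (y (inject₁ i) +[ α i ] toℚ (g i))
    maximal  : ∀ i (β : ℚ) → α i ℚ.< β →
               ¬ InP A b B d (y (inject₁ i) +[ β ] toℚ (g i))

IntegralWalk : ∀ {m p n} {A : Matℤ m n} {b : Vecℚ m} {B : Matℤ p n} {d : Vecℚ p}
               {v₁ v₂ : Vecℚ n} → CircuitWalk A b B d v₁ v₂ → Set
IntegralWalk W = ∀ i → IsIntegralVec (CircuitWalk.y W i)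

{-# OPTIONS --safe #-}
module Submission where

-- A step y ↦ y + α g of a circuit walk stops because some constraint i₀ with (B g)ᵢ₀ > 0 has
-- become tight.  The new point then solves the system made of A x = b, the rows of B on which
-- B g vanishes (their values do not change along the step) and row i₀.  This system has only
-- the trivial kernel, since a kernel vector h would have supp (B h) ⊊ supp (B g), against the
-- minimality of the circuit.  All its right-hand sides are integral: those inherited from y
-- because y is integral, and dᵢ₀ because the face where row i₀ is tight contains a vertex of P
-- (P is pointed, having the vertex v₁), and vertices are integral.  The system is a row
-- selection of the totally unimodular matrix (A over B), and Gaussian elimination with ±1
-- pivots, which preserves total unimodularity, shows that its unique solution is integral.

open import Defs
open import Data.Nat as ℕ using (ℕ; zero; suc)
import Data.Nat.Properties as ℕP
import Data.Nat.Coprimality as Coprime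
open import Data.Integer as ℤ using (ℤ; +0; +[1+_]; -[1+_]; 0ℤ; 1ℤ; -1ℤ)
import Data.Integer.Properties as ℤP
open import Data.Integer.Tactic.RingSolver using () renaming (ring to ℤ-ring)
open import Data.Rational as ℚ using (ℚ; 0ℚ; 1ℚ; ½; mkℚ)
import Data.Rational.Properties as ℚP
open import Data.Fin using (Fin; zero; suc; punchIn; punchOut; inject₁; toℕ; fromℕ; fromℕ<; lower₁; splitAt; _↑ˡ_; _↑ʳ_; _≟_)
open import Data.Fin.Properties
  using (toℕ-inject₁; toℕ<n; toℕ-injective; toℕ-fromℕ; toℕ-fromℕ<; inject₁-lower₁; punchIn-injective;
         punchInᵢ≢i; punchIn-punchOut; suc-injective; splitAt-↑ˡ; splitAt-↑ʳ; any?; all?; ¬∀⟶∃¬)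
open import Data.Fin.Induction using (<-weakInduction)
open import Data.Fin.Subset using (Subset; _∈_; _⊆_; _⊃_)
open import Data.Fin.Subset.Induction using (⊃-wellFounded; Acc; acc)
open import Data.Vec using (tabulate)
open import Data.Vec.Properties using (lookup∘tabulate; []=⇒lookup; lookup⇒[]=)
open import Data.Vec.Functional using (updateAt; tail; _∷_)
open import Data.Vec.Functional.Properties using (updateAt-updates; updateAt-minimal)
open import Data.Unit using (⊤; tt)
open import Data.Product using (Σ; ∃; _×_; _,_; proj₁; proj₂)
open import Data.Sum using (_⊎_; inj₁; inj₂; [_,_]′)
open import Data.Empty using (⊥-elim)
open import Function using (_∘_; const)
open import Function.Definitions using (Injective)
open import Relation.Nullary using (¬_; Dec; yes; no; does)
open import Relation.Nullary.Decidable
  using (¬?; _×-dec_; _⊎-dec_; decidable-stable; dec-true; dec⇒maybe; toWitness)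
open import Relation.Unary using (Decidable)
open import Relation.Binary.PropositionalEquality
open import Tactic.RingSolver using (solve-∀)
import Tactic.RingSolver.Core.AlmostCommutativeRing as ACR

module Determinant where

  open import Data.Integer using (_+_; _*_; -_; _-_)

  sumℤ-cong : ∀ k {f g : Fin k → ℤ} → f ≗ g → sumℤ k f ≡ sumℤ k g
  sumℤ-cong zero    f≗g = refl
  sumℤ-cong (suc k) f≗g = cong₂ _+_ (f≗g zero) (sumℤ-cong k (f≗g ∘ suc))

  sumℤ-zero : ∀ k {f : Fin k → ℤ} → f ≗ const 0ℤ → sumℤ k f ≡ 0ℤ
  sumℤ-zero zero    f≗0 = refl
  sumℤ-zero (suc k) f≗0 = cong₂ _+_ (f≗0 zero) (sumℤ-zero k (f≗0 ∘ suc))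

  sumℤ-linear : ∀ k (f g : Fin k → ℤ) t →
    sumℤ k (λ i → f i + t * g i) ≡ sumℤ k f + t * sumℤ k g
  sumℤ-linear zero    f g t = sym (trans (ℤP.+-identityˡ _) (ℤP.*-zeroʳ t))
  sumℤ-linear (suc k) f g t = trans
    (cong ((f zero + t * g zero) +_) (sumℤ-linear k (f ∘ suc) (g ∘ suc) t))
    (regroup (f zero) (g zero) (sumℤ k (f ∘ suc)) (sumℤ k (g ∘ suc)) t)
    where
    regroup : ∀ a b c d t → a + t * b + (c + t * d) ≡ a + c + t * (b + d)
    regroup = solve-∀ ℤ-ring

  sumℤ-neg : ∀ k (f : Fin k → ℤ) → sumℤ k (-_ ∘ f) ≡ - sumℤ k f
  sumℤ-neg zero    f = refl
  sumℤ-neg (suc k) f =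
    trans (cong (- f zero +_) (sumℤ-neg k (f ∘ suc))) (sym (ℤP.neg-distrib-+ (f zero) _))

  swapAdj : ∀ {k} → Fin k → Fin (suc k) → Fin (suc k)
  swapAdj zero    zero          = suc zero
  swapAdj zero    (suc zero)    = zero
  swapAdj zero    (suc (suc j)) = suc (suc j)
  swapAdj (suc c) zero          = zero
  swapAdj (suc c) (suc j)       = suc (swapAdj c j)

  swapAdj-inject₁ : ∀ {k} (c : Fin k) → swapAdj c (inject₁ c) ≡ suc c
  swapAdj-inject₁ zero    = refl
  swapAdj-inject₁ (suc c) = cong suc (swapAdj-inject₁ c)

  swapAdj-suc : ∀ {k} (c : Fin k) → swapAdj c (suc c) ≡ inject₁ c
  swapAdj-suc zero    = refl
  swapAdj-suc (suc c) = cong suc (swapAdj-suc c)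

  swapAdj-punchIn-inject₁ : ∀ {k} (c : Fin k) x → swapAdj c (punchIn (inject₁ c) x) ≡ punchIn (suc c) x
  swapAdj-punchIn-inject₁ zero    zero    = refl
  swapAdj-punchIn-inject₁ zero    (suc x) = refl
  swapAdj-punchIn-inject₁ (suc c) zero    = refl
  swapAdj-punchIn-inject₁ (suc c) (suc x) = cong suc (swapAdj-punchIn-inject₁ c x)

  swapAdj-punchIn-suc : ∀ {k} (c : Fin k) x → swapAdj c (punchIn (suc c) x) ≡ punchIn (inject₁ c) x
  swapAdj-punchIn-suc zero    zero    = refl
  swapAdj-punchIn-suc zero    (suc x) = refl
  swapAdj-punchIn-suc (suc c) zero    = refl
  swapAdj-punchIn-suc (suc c) (suc x) = cong suc (swapAdj-punchIn-suc c x)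

  -- Away from the two swapped positions, deleting a position commutes with
  -- the transposition (shifted to the remaining positions).
  data SwapAdjView : ∀ {k} → Fin k → Fin (suc k) → Set where
    at-inject₁ : ∀ {k} {c : Fin k} → SwapAdjView c (inject₁ c)
    at-suc     : ∀ {k} {c : Fin k} → SwapAdjView c (suc c)
    elsewhere  : ∀ {k} {c : Fin (suc k)} {j} (c′ : Fin k) → swapAdj c j ≡ j →
                 (∀ x → swapAdj c (punchIn j x) ≡ punchIn j (swapAdj c′ x)) → SwapAdjView c j

  swapAdjView : ∀ {k} (c : Fin k) j → SwapAdjView c j
  swapAdjView zero    zero       = at-inject₁
  swapAdjView zero    (suc zero) = at-suc
  swapAdjView {suc (suc _)} zero (suc (suc j)) =
    elsewhere zero refl λ { zero → refl ; (suc zero) → refl ; (suc (suc x)) → refl }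
  swapAdjView (suc c) zero       = elsewhere c refl λ x → refl
  swapAdjView (suc c) (suc j) with swapAdjView c j
  ... | at-inject₁          = at-inject₁
  ... | at-suc              = at-suc
  ... | elsewhere c′ fix eq = elsewhere (suc c′) (cong suc fix) λ { zero → refl ; (suc x) → cong suc (eq x) }

  sumℤ-swapAdj : ∀ k (c : Fin k) (f : Fin (suc k) → ℤ) → sumℤ (suc k) (f ∘ swapAdj c) ≡ sumℤ (suc k) f
  sumℤ-swapAdj (suc k) zero    f = exchange (f zero) (f (suc zero)) _
    where
    exchange : ∀ a b c → b + (a + c) ≡ a + (b + c)
    exchange = solve-∀ ℤ-ring
  sumℤ-swapAdj (suc k) (suc c) f = cong (f zero +_) (sumℤ-swapAdj k c (f ∘ suc))

  permuteColumns : ∀ {m n} → Matℤ m n → (Fin n → Fin n) → Matℤ m n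
  permuteColumns M σ i j = M i (σ j)

  minor : ∀ {k} → Matℤ (suc k) (suc k) → Fin (suc k) → Matℤ k k
  minor M j r c = M (suc r) (punchIn j c)

  expansionTerm : ∀ {k} → Matℤ (suc k) (suc k) → Fin (suc k) → ℤ
  expansionTerm {k} M j = signℤ (toℕ j) * (M zero j * det k (minor M j))

  signℤ-suc : ∀ n → signℤ (suc n) ≡ - signℤ n
  signℤ-suc zero          = refl
  signℤ-suc (suc zero)    = refl
  signℤ-suc (suc (suc n)) = signℤ-suc n

  det-cong : ∀ k {M N : Matℤ k k} → (∀ i j → M i j ≡ N i j) → det k M ≡ det k N
  det-cong zero    M≡N = refl
  det-cong (suc k) M≡N = sumℤ-cong (suc k) λ j →
    cong₂ (λ a d → signℤ (toℕ j) * (a * d)) (M≡N zero j) (det-cong k λ r c → M≡N (suc r) (punchIn j c))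

  -- The two swapped columns exchange their expansion terms, whose signs differ.
  expansionTerm-exchanged : ∀ {k} (M : Matℤ (suc k) (suc k)) (σ : Fin (suc k) → Fin (suc k)) j {j′} →
    σ j ≡ j′ → signℤ (toℕ j) ≡ - signℤ (toℕ j′) → (∀ x → σ (punchIn j x) ≡ punchIn j′ x) →
    expansionTerm (permuteColumns M σ) j ≡ - expansionTerm M (σ j)
  expansionTerm-exchanged {k} M σ j {j′} refl sign≡ punch≡ = begin
    signℤ (toℕ j) * (M zero j′ * det k (λ r x → M (suc r) (σ (punchIn j x))))
      ≡⟨ cong₂ (λ s d → s * (M zero j′ * d)) sign≡ (det-cong k λ r x → cong (M (suc r)) (punch≡ x)) ⟩
    - signℤ (toℕ j′) * (M zero j′ * det k (minor M j′))
      ≡⟨ ℤP.neg-distribˡ-* (signℤ (toℕ j′)) _ ⟨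
    - expansionTerm M j′ ∎
    where open ≡-Reasoning

  det-swapAdj : ∀ k (M : Matℤ (suc k) (suc k)) (c : Fin k) →
    det (suc k) (permuteColumns M (swapAdj c)) ≡ - det (suc k) M

  expansionTerm-swapAdj : ∀ {k} (M : Matℤ (suc k) (suc k)) (c : Fin k) j → SwapAdjView c j →
    expansionTerm (permuteColumns M (swapAdj c)) j ≡ - expansionTerm M (swapAdj c j)
  expansionTerm-swapAdj M c _ at-inject₁ = expansionTerm-exchanged M (swapAdj c) (inject₁ c) (swapAdj-inject₁ c)
    (trans (cong signℤ (toℕ-inject₁ c)) (trans (sym (ℤP.neg-involutive _)) (cong -_ (sym (signℤ-suc (toℕ c))))))
    (swapAdj-punchIn-inject₁ c)
  expansionTerm-swapAdj M c _ at-suc = expansionTerm-exchanged M (swapAdj c) (suc c) (swapAdj-suc c)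
    (trans (signℤ-suc (toℕ c)) (cong (-_ ∘ signℤ) (sym (toℕ-inject₁ c))))
    (swapAdj-punchIn-suc c)
  expansionTerm-swapAdj {k} M c j (elsewhere c′ fix punch≡) = begin
    signℤ (toℕ j) * (M zero (swapAdj c j) * det k (λ r x → M (suc r) (swapAdj c (punchIn j x))))
      ≡⟨ cong₂ (λ a d → signℤ (toℕ j) * (M zero a * d)) fix (det-cong k λ r x → cong (M (suc r)) (punch≡ x)) ⟩
    signℤ (toℕ j) * (M zero j * det k (permuteColumns (minor M j) (swapAdj c′)))
      ≡⟨ cong (λ d → signℤ (toℕ j) * (M zero j * d)) (det-swapAdj _ (minor M j) c′) ⟩
    signℤ (toℕ j) * (M zero j * - det k (minor M j))
      ≡⟨ move-sign (signℤ (toℕ j)) (M zero j) _ ⟩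
    - expansionTerm M j
      ≡⟨ cong (-_ ∘ expansionTerm M) fix ⟨
    - expansionTerm M (swapAdj c j) ∎
    where
    open ≡-Reasoning
    move-sign : ∀ s a d → s * (a * - d) ≡ - (s * (a * d))
    move-sign = solve-∀ ℤ-ring

  det-swapAdj k M c = begin
    sumℤ (suc k) (expansionTerm (permuteColumns M (swapAdj c)))
      ≡⟨ sumℤ-cong (suc k) (λ j → expansionTerm-swapAdj M c j (swapAdjView c j)) ⟩
    sumℤ (suc k) (-_ ∘ expansionTerm M ∘ swapAdj c)
      ≡⟨ sumℤ-neg (suc k) (expansionTerm M ∘ swapAdj c) ⟩
    - sumℤ (suc k) (expansionTerm M ∘ swapAdj c)
      ≡⟨ cong -_ (sumℤ-swapAdj k c (expansionTerm M)) ⟩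
    - det (suc k) M ∎
    where open ≡-Reasoning

  self-negating : ∀ x → x ≡ - x → x ≡ 0ℤ
  self-negating +0       _  = refl
  self-negating +[1+ n ] ()
  self-negating -[1+ n ] ()

  det-equal-adjacent-columns : ∀ k (M : Matℤ (suc k) (suc k)) (c : Fin k) →
    (∀ i → M i (inject₁ c) ≡ M i (suc c)) → det (suc k) M ≡ 0ℤ
  det-equal-adjacent-columns k M c same =
    self-negating _ (trans (det-cong (suc k) λ i j → unchanged i j (swapAdjView c j)) (det-swapAdj k M c))
    where
    unchanged : ∀ i j → SwapAdjView c j → M i j ≡ M i (swapAdj c j)
    unchanged i _ at-inject₁          = trans (same i) (cong (M i) (sym (swapAdj-inject₁ c)))
    unchanged i _ at-suc              = trans (sym (same i)) (cong (M i) (sym (swapAdj-suc c)))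
    unchanged i _ (elsewhere _ fix _) = cong (M i) (sym fix)

  det-equal-columns : ∀ k (M : Matℤ (suc k) (suc k)) (l : Fin k) →
    (∀ i → M i zero ≡ M i (suc l)) → det (suc k) M ≡ 0ℤ
  det-equal-columns (suc k) M l = <-weakInduction P base step l M
    where
    P : Fin (suc k) → Set
    P l = ∀ M → (∀ i → M i zero ≡ M i (suc l)) → det (suc (suc k)) M ≡ 0ℤ
    base : P zero
    base M = det-equal-adjacent-columns (suc k) M zero
    -- swapping columns l + 1 and l + 2 moves the copy of column 0 one step left
    step : ∀ l → P (inject₁ l) → P (suc l)
    step l hyp M same = trans (sym (ℤP.neg-involutive _)) (cong -_ (trans (sym (det-swapAdj (suc k) M (suc l)))
      (hyp (permuteColumns M (swapAdj (suc l))) λ i → trans (same i) (cong (M i) (sym (swapAdj-inject₁ (suc l)))))))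

  ColumnCombination : ∀ {k} → Matℤ k k → Matℤ k k → Matℤ k k → Fin k → ℤ → Set
  ColumnCombination M M₁ M₂ l t =
    (∀ i j → j ≢ l → M₁ i j ≡ M i j × M₂ i j ≡ M i j) × (∀ i → M i l ≡ M₁ i l + t * M₂ i l)

  ColumnCombination-minor : ∀ {k} {M M₁ M₂ : Matℤ (suc k) (suc k)} {l t j} → ColumnCombination M M₁ M₂ l t →
    (j≢l : j ≢ l) → ColumnCombination (minor M j) (minor M₁ j) (minor M₂ j) (punchOut j≢l) t
  ColumnCombination-minor {M = M} {M₁} {M₂} {l} {t} {j} (off , at) j≢l =
    (λ r c c≢l′ → off (suc r) (punchIn j c) (c≢l′ ∘ punchIn-injective j c _ ∘ λ eq → trans eq (sym punchIn-l′))) ,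
    (λ r → subst (λ x → M (suc r) x ≡ M₁ (suc r) x + t * M₂ (suc r) x) (sym punchIn-l′) (at (suc r)))
    where
    punchIn-l′ : punchIn j (punchOut j≢l) ≡ l
    punchIn-l′ = punchIn-punchOut j≢l

  det-linear-column : ∀ k {M M₁ M₂ : Matℤ k k} {l t} → ColumnCombination M M₁ M₂ l t →
    det k M ≡ det k M₁ + t * det k M₂
  det-linear-column (suc k) {M} {M₁} {M₂} {l} {t} comb@(off , at) =
    trans (sumℤ-cong (suc k) term) (sumℤ-linear (suc k) (expansionTerm M₁) (expansionTerm M₂) t)
    where
    open ≡-Reasoning
    distribˡ : ∀ s a b d t → s * ((a + t * b) * d) ≡ s * (a * d) + t * (s * (b * d))
    distribˡ = solve-∀ ℤ-ring
    distribʳ : ∀ s a d e t → s * (a * (d + t * e)) ≡ s * (a * d) + t * (s * (a * e))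
    distribʳ = solve-∀ ℤ-ring
    term : ∀ j → expansionTerm M j ≡ expansionTerm M₁ j + t * expansionTerm M₂ j
    term j with j ≟ l
    ... | yes refl = begin
      s * (M zero j * D)                                 ≡⟨ cong (λ a → s * (a * D)) (at zero) ⟩
      s * ((M₁ zero j + t * M₂ zero j) * D)              ≡⟨ distribˡ s (M₁ zero j) (M₂ zero j) D t ⟩
      s * (M₁ zero j * D) + t * (s * (M₂ zero j * D))    ≡⟨ cong₂ (λ d₁ d₂ → s * (M₁ zero j * d₁) + t * (s * (M₂ zero j * d₂)))
                                                              (minor-off proj₁) (minor-off proj₂) ⟩
      expansionTerm M₁ j + t * expansionTerm M₂ j        ∎
      where
      s = signℤ (toℕ j)
      D = det k (minor M j)
      minor-off : ∀ {N} → (∀ {i c} → M₁ i c ≡ M i c × M₂ i c ≡ M i c → N i c ≡ M i c) → D ≡ det k (minor N j)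
      minor-off pick = det-cong k λ r c → sym (pick (off (suc r) (punchIn j c) (punchInᵢ≢i j c)))
    ... | no j≢l = begin
      s * (M zero j * det k (minor M j))
        ≡⟨ cong (λ d → s * (M zero j * d)) (det-linear-column k {t = t} (ColumnCombination-minor {M = M} {M₁} {M₂} {l} {t} comb j≢l)) ⟩
      s * (M zero j * (det k (minor M₁ j) + t * det k (minor M₂ j)))
        ≡⟨ distribʳ s (M zero j) _ _ t ⟩
      s * (M zero j * det k (minor M₁ j)) + t * (s * (M zero j * det k (minor M₂ j)))
        ≡⟨ cong₂ (λ a b → s * (a * det k (minor M₁ j)) + t * (s * (b * det k (minor M₂ j))))
             (sym (proj₁ (off zero j j≢l))) (sym (proj₂ (off zero j j≢l))) ⟩
      expansionTerm M₁ j + t * expansionTerm M₂ j ∎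
      where s = signℤ (toℕ j)

  det-add-column-multiple : ∀ k (M : Matℤ (suc k) (suc k)) (l : Fin k) t →
    det (suc k) (λ i → updateAt (M i) (suc l) (λ a → a + t * M i zero)) ≡ det (suc k) M
  det-add-column-multiple k M l t = begin
    det (suc k) M′                  ≡⟨ det-linear-column (suc k) {M′} {M} {M₀} {suc l} {t} (off-l , at-l) ⟩
    det (suc k) M + t * det (suc k) M₀ ≡⟨ cong (λ d → det (suc k) M + t * d) (det-equal-columns k M₀ l M₀-repeats) ⟩
    det (suc k) M + t * 0ℤ          ≡⟨ trans (cong (det (suc k) M +_) (ℤP.*-zeroʳ t)) (ℤP.+-identityʳ _) ⟩
    det (suc k) M                   ∎
    where
    open ≡-Reasoning
    M′ M₀ : Matℤ (suc k) (suc k)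
    M′ i = updateAt (M i) (suc l) (λ a → a + t * M i zero)
    M₀ i = updateAt (M i) (suc l) (const (M i zero))
    untouched : ∀ i (f : ℤ → ℤ) j → j ≢ suc l → updateAt (M i) (suc l) f j ≡ M i j
    untouched i f j j≢ = updateAt-minimal j (suc l) (M i) j≢
    off-l : ∀ i j → j ≢ suc l → M i j ≡ M′ i j × M₀ i j ≡ M′ i j
    off-l i j j≢ = sym (untouched i (λ a → a + t * M i zero) j j≢) ,
                   trans (untouched i (const (M i zero)) j j≢) (sym (untouched i (λ a → a + t * M i zero) j j≢))
    at-l : ∀ i → M′ i (suc l) ≡ M i (suc l) + t * M₀ i (suc l)
    at-l i = trans (updateAt-updates (suc l) (M i)) (cong (λ a → M i (suc l) + t * a) (sym (updateAt-updates (suc l) (M i))))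
    M₀-repeats : ∀ i → M₀ i zero ≡ M₀ i (suc l)
    M₀-repeats i = trans (updateAt-minimal zero (suc l) {const (M i zero)} (M i) λ ()) (sym (updateAt-updates (suc l) (M i)))

  addMultiplesOfColumn0 : ∀ {k} → Matℤ (suc k) (suc k) → (Fin k → ℤ) → Matℤ (suc k) (suc k)
  addMultiplesOfColumn0 Q w i zero    = Q i zero
  addMultiplesOfColumn0 Q w i (suc l) = Q i (suc l) + w l * Q i zero

  -- Induction on a bound n for the support of the weights, peeling off the weight at position n.
  det-addMultiplesOfColumn0 : ∀ k (Q : Matℤ (suc k) (suc k)) w →
    det (suc k) (addMultiplesOfColumn0 Q w) ≡ det (suc k) Q
  det-addMultiplesOfColumn0 k Q w = go k w λ l k≤l → ⊥-elim (ℕP.<⇒≱ (toℕ<n l) k≤l)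
    where
    go : ∀ n w → (∀ l → n ℕ.≤ toℕ l → w l ≡ 0ℤ) → det (suc k) (addMultiplesOfColumn0 Q w) ≡ det (suc k) Q
    go zero w w≡0 = det-cong (suc k) {addMultiplesOfColumn0 Q w} {Q} λ
      { i zero    → refl
      ; i (suc l) → trans (cong (λ a → Q i (suc l) + a * Q i zero) (w≡0 l ℕ.z≤n)) (ℤP.+-identityʳ (Q i (suc l))) }
    go (suc n) w w≡0 with n ℕ.<? k
    ... | no n≮k = go n w λ l n≤l → ⊥-elim (n≮k (ℕP.≤-<-trans n≤l (toℕ<n l)))
    ... | yes n<k = trans (det-cong (suc k) peel)
                      (trans (det-add-column-multiple k (addMultiplesOfColumn0 Q w′) l₀ (w l₀)) (go n w′ w′≡0))
      where
      l₀ = fromℕ< n<k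
      w′ = updateAt w l₀ (const 0ℤ)
      w′≡0 : ∀ l → n ℕ.≤ toℕ l → w′ l ≡ 0ℤ
      w′≡0 l n≤l with l ≟ l₀
      ... | yes refl = updateAt-updates l₀ w
      ... | no l≢l₀  = trans (updateAt-minimal l l₀ w l≢l₀) (w≡0 l (ℕP.≤∧≢⇒< n≤l λ n≡l →
                         l≢l₀ (toℕ-injective (trans (sym n≡l) (sym (toℕ-fromℕ< n<k))))))
      peel : ∀ i j → addMultiplesOfColumn0 Q w i j
                     ≡ updateAt (addMultiplesOfColumn0 Q w′ i) (suc l₀) (λ a → a + w l₀ * Q i zero) j
      peel i zero    = refl
      peel i (suc l) with l ≟ l₀
      ... | yes refl = sym (trans (updateAt-updates (suc l₀) (addMultiplesOfColumn0 Q w′ i))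
                         (cong (λ a → a + w l₀ * Q i zero) (trans (cong (λ a → Q i (suc l₀) + a * Q i zero)
                           (updateAt-updates l₀ w)) (ℤP.+-identityʳ (Q i (suc l₀))))))
      ... | no l≢l₀  = sym (trans (updateAt-minimal (suc l) (suc l₀) (addMultiplesOfColumn0 Q w′ i) (l≢l₀ ∘ suc-injective))
                         (cong (λ a → Q i (suc l) + a * Q i zero) (updateAt-minimal l l₀ w l≢l₀)))

  det-first-row-single : ∀ k (M : Matℤ (suc k) (suc k)) → (∀ j → M zero (suc j) ≡ 0ℤ) →
    det (suc k) M ≡ M zero zero * det k (minor M zero)
  det-first-row-single k M row≡0 = trans
    (cong₂ _+_ (ℤP.*-identityˡ (M zero zero * det k (minor M zero))) (sumℤ-zero k λ j →
       trans (cong (λ a → signℤ (toℕ (suc j)) * (a * det k (minor M (suc j)))) (row≡0 j)) (ℤP.*-zeroʳ (signℤ (toℕ (suc j))))))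
    (ℤP.+-identityʳ (M zero zero * det k (minor M zero)))

  -- Pivoting on a ±1 entry

  IsUnit : ℤ → Set
  IsUnit e = e ≡ 1ℤ ⊎ e ≡ -1ℤ

  IsTUValue : ℤ → Set
  IsTUValue δ = δ ≡ 0ℤ ⊎ δ ≡ 1ℤ ⊎ δ ≡ -1ℤ

  unit*TUValue : ∀ {e δ} → IsUnit e → IsTUValue δ → IsTUValue (e * δ)
  unit*TUValue (inj₁ refl) (inj₁ refl)        = inj₁ refl
  unit*TUValue (inj₁ refl) (inj₂ (inj₁ refl)) = inj₂ (inj₁ refl)
  unit*TUValue (inj₁ refl) (inj₂ (inj₂ refl)) = inj₂ (inj₂ refl)
  unit*TUValue (inj₂ refl) (inj₁ refl)        = inj₁ refl
  unit*TUValue (inj₂ refl) (inj₂ (inj₁ refl)) = inj₂ (inj₂ refl)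
  unit*TUValue (inj₂ refl) (inj₂ (inj₂ refl)) = inj₂ (inj₁ refl)

  unit*unit : ∀ {e} → IsUnit e → e * e ≡ 1ℤ
  unit*unit (inj₁ refl) = refl
  unit*unit (inj₂ refl) = refl

  TU-entry : ∀ {m n} (M : Matℤ m n) → TotallyUnimodular M → ∀ i j → IsTUValue (M i j)
  TU-entry M tu i j = subst IsTUValue det₁ (tu 1 (const i) (const j) Fin1-injective Fin1-injective)
    where
    det₁ : det 1 (λ _ _ → M i j) ≡ M i j
    det₁ = trans (ℤP.+-identityʳ _) (trans (ℤP.*-identityˡ _) (ℤP.*-identityʳ _))
    Fin1-injective : ∀ {A : Set} {f : Fin 1 → A} → Injective _≡_ _≡_ f
    Fin1-injective {x = zero} {zero} _ = refl

  ∷-injective : ∀ {k n} {x : Fin n} {f : Fin k → Fin n} → (∀ i → f i ≢ x) →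
    Injective _≡_ _≡_ f → Injective _≡_ _≡_ (x ∷ f)
  ∷-injective f≢x f-inj {zero}  {zero}  _     = refl
  ∷-injective f≢x f-inj {zero}  {suc j} x≡fj  = ⊥-elim (f≢x j (sym x≡fj))
  ∷-injective f≢x f-inj {suc i} {zero}  fi≡x  = ⊥-elim (f≢x i fi≡x)
  ∷-injective f≢x f-inj {suc i} {suc j} fi≡fj = cong suc (f-inj fi≡fj)

  -- The Schur complement of the entry (0, 0), written for an entry e = ±1, so that e⁻¹ = e.
  schurComplement : ∀ {k} → Matℤ (suc k) (suc k) → Matℤ k k
  schurComplement Q a c = Q (suc a) (suc c) - Q (suc a) zero * Q zero zero * Q zero (suc c)

  det-schurComplement : ∀ k (Q : Matℤ (suc k) (suc k)) → IsUnit (Q zero zero) →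
    det (suc k) Q ≡ Q zero zero * det k (schurComplement Q)
  det-schurComplement k Q unit = begin
    det (suc k) Q                                       ≡⟨ det-addMultiplesOfColumn0 k Q w ⟨
    det (suc k) (addMultiplesOfColumn0 Q w)             ≡⟨ det-first-row-single k (addMultiplesOfColumn0 Q w) row₀-cleared ⟩
    e * det k (minor (addMultiplesOfColumn0 Q w) zero)  ≡⟨ cong (e *_) (det-cong k λ a c →
                                                             schur (Q (suc a) (suc c)) (Q (suc a) zero) e (Q zero (suc c))) ⟩
    e * det k (schurComplement Q)                       ∎
    where
    open ≡-Reasoning
    e = Q zero zero
    w : Fin k → ℤ
    w l = - (e * Q zero (suc l))
    cancel : ∀ a e → a + - (e * a) * e ≡ a - a * (e * e)
    cancel = solve-∀ ℤ-ring
    schur : ∀ x a e b → x + - (e * b) * a ≡ x - a * e * b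
    schur = solve-∀ ℤ-ring
    row₀-cleared : ∀ l → addMultiplesOfColumn0 Q w zero (suc l) ≡ 0ℤ
    row₀-cleared l = let a = Q zero (suc l) in begin
      a + - (e * a) * e  ≡⟨ cancel a e ⟩
      a - a * (e * e)    ≡⟨ cong (λ u → a - a * u) (unit*unit unit) ⟩
      a - a * 1ℤ         ≡⟨ cong (λ u → a - u) (ℤP.*-identityʳ a) ⟩
      a - a              ≡⟨ ℤP.+-inverseʳ a ⟩
      0ℤ                 ∎

  pivot : ∀ {K n} → Matℤ (suc K) (suc n) → Fin (suc K) → Matℤ K n
  pivot M r s l = M (punchIn r s) (suc l) - M (punchIn r s) zero * M r zero * M r (suc l)

  -- Each square submatrix of the pivoted matrix is the Schur complement of a submatrix of M
  -- through the pivot.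
  pivot-TU : ∀ {K n} (M : Matℤ (suc K) (suc n)) r →
    TotallyUnimodular M → IsUnit (M r zero) → TotallyUnimodular (pivot M r)
  pivot-TU M r tu unit q R C R-inj C-inj =
    subst IsTUValue det-pivot (unit*TUValue unit (tu (suc q) ρ γ ρ-inj γ-inj))
    where
    open ≡-Reasoning
    e = M r zero
    ρ = r ∷ (punchIn r ∘ R)
    γ = zero ∷ (suc ∘ C)
    ρ-inj : Injective _≡_ _≡_ ρ
    ρ-inj = ∷-injective (λ i → punchInᵢ≢i r (R i)) (R-inj ∘ punchIn-injective r _ _)
    γ-inj : Injective _≡_ _≡_ γ
    γ-inj = ∷-injective (λ i ()) (C-inj ∘ suc-injective)
    δ = det q (subMatrix (pivot M r) R C)
    det-pivot : e * det (suc q) (subMatrix M ρ γ) ≡ δ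
    det-pivot = begin
      e * det (suc q) (subMatrix M ρ γ)  ≡⟨ cong (e *_) (det-schurComplement q (subMatrix M ρ γ) unit) ⟩
      e * (e * δ)                        ≡⟨ ℤP.*-assoc e e δ ⟨
      e * e * δ                          ≡⟨ cong (_* δ) (unit*unit unit) ⟩
      1ℤ * δ                             ≡⟨ ℤP.*-identityˡ δ ⟩
      δ                                  ∎

open Determinant
open import Data.Rational using (_+_; _*_; -_; _-_; _÷_; _≤_; _<_)

-- The zero test lets the ring solver cancel numeric coefficients such as 1ℚ - 1ℚ.
ℚ-ring : ACR.AlmostCommutativeRing _ _
ℚ-ring = ACR.fromCommutativeRing ℚP.+-*-commutativeRing (dec⇒maybe ∘ (0ℚ ℚP.≟_))

-- Integral rationals

-- ℤ→ℚ z normalises z / 1, which is already in lowest terms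
ℤ→ℚ≡mkℚ : ∀ z → ℤ→ℚ z ≡ mkℚ z 0 (Coprime.sym (Coprime.1-coprimeTo ℤ.∣ z ∣))
ℤ→ℚ≡mkℚ z = ℚP.↥p/↧p≡p (mkℚ z 0 (Coprime.sym (Coprime.1-coprimeTo ℤ.∣ z ∣)))

ℤ→ℚ-+ : ∀ a b → ℤ→ℚ (a ℤ.+ b) ≡ ℤ→ℚ a + ℤ→ℚ b
ℤ→ℚ-+ a b = sym (trans (cong₂ _+_ (ℤ→ℚ≡mkℚ a) (ℤ→ℚ≡mkℚ b))
  (cong₂ (λ x y → (x ℤ.+ y) ℚ./ 1) (ℤP.*-identityʳ a) (ℤP.*-identityʳ b)))

ℤ→ℚ-* : ∀ a b → ℤ→ℚ (a ℤ.* b) ≡ ℤ→ℚ a * ℤ→ℚ b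
ℤ→ℚ-* a b = sym (cong₂ _*_ (ℤ→ℚ≡mkℚ a) (ℤ→ℚ≡mkℚ b))

ℤ→ℚ-neg : ∀ a → ℤ→ℚ (ℤ.- a) ≡ - ℤ→ℚ a
ℤ→ℚ-neg a = trans (ℤ→ℚ≡mkℚ (ℤ.- a)) (trans (neg-mkℚ a) (cong -_ (sym (ℤ→ℚ≡mkℚ a))))
  where
  neg-mkℚ : ∀ a → mkℚ (ℤ.- a) 0 (Coprime.sym (Coprime.1-coprimeTo ℤ.∣ ℤ.- a ∣))
                  ≡ - mkℚ a 0 (Coprime.sym (Coprime.1-coprimeTo ℤ.∣ a ∣))
  neg-mkℚ ℤ.+0       = refl
  neg-mkℚ ℤ.+[1+ n ] = refl
  neg-mkℚ ℤ.-[1+ n ] = refl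

ℤ→ℚ-unit² : ∀ {e} → IsUnit e → ℤ→ℚ e * ℤ→ℚ e ≡ 1ℚ
ℤ→ℚ-unit² {e} unit = trans (sym (ℤ→ℚ-* e e)) (cong ℤ→ℚ (unit*unit unit))

Integral : ℚ → Set
Integral q = ∃ λ z → q ≡ ℤ→ℚ z

Integral-+ : ∀ {p q} → Integral p → Integral q → Integral (p + q)
Integral-+ (a , refl) (b , refl) = a ℤ.+ b , sym (ℤ→ℚ-+ a b)

Integral-* : ∀ {p q} → Integral p → Integral q → Integral (p * q)
Integral-* (a , refl) (b , refl) = a ℤ.* b , sym (ℤ→ℚ-* a b)

Integral-neg : ∀ {p} → Integral p → Integral (- p)
Integral-neg (a , refl) = ℤ.- a , sym (ℤ→ℚ-neg a)

Integral-ℤ : ∀ z → Integral (ℤ→ℚ z)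
Integral-ℤ z = z , refl

sumℚ-cong : ∀ k {f g : Fin k → ℚ} → f ≗ g → sumℚ k f ≡ sumℚ k g
sumℚ-cong zero    f≗g = refl
sumℚ-cong (suc k) f≗g = cong₂ _+_ (f≗g zero) (sumℚ-cong k (f≗g ∘ suc))

sumℚ-zero : ∀ k {f : Fin k → ℚ} → f ≗ const 0ℚ → sumℚ k f ≡ 0ℚ
sumℚ-zero zero    f≗0 = refl
sumℚ-zero (suc k) f≗0 = cong₂ _+_ (f≗0 zero) (sumℚ-zero k (f≗0 ∘ suc))

sumℚ-linear : ∀ k (f g : Fin k → ℚ) t → sumℚ k (λ i → f i + t * g i) ≡ sumℚ k f + t * sumℚ k g
sumℚ-linear zero    f g t = regroup₀ t
  where
  regroup₀ : ∀ t → 0ℚ ≡ 0ℚ + t * 0ℚ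
  regroup₀ = solve-∀ ℚ-ring
sumℚ-linear (suc k) f g t = trans
  (cong ((f zero + t * g zero) +_) (sumℚ-linear k (f ∘ suc) (g ∘ suc) t))
  (regroup (f zero) (g zero) (sumℚ k (f ∘ suc)) (sumℚ k (g ∘ suc)) t)
  where
  regroup : ∀ a b c d t → a + t * b + (c + t * d) ≡ a + c + t * (b + d)
  regroup = solve-∀ ℚ-ring

sumℚ-Integral : ∀ k {f : Fin k → ℚ} → (∀ i → Integral (f i)) → Integral (sumℚ k f)
sumℚ-Integral zero    _     = Integral-ℤ 0ℤ
sumℚ-Integral (suc k) f-int = Integral-+ (f-int zero) (sumℚ-Integral k (f-int ∘ suc))

·-cong : ∀ {m n} (M : Matℤ m n) {x y : Vecℚ n} → x ≗ y → ∀ i → (M · x) i ≡ (M · y) i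
·-cong M x≗y i = sumℚ-cong _ λ j → cong (ℤ→ℚ (M i j) *_) (x≗y j)

·-+[] : ∀ {m n} (M : Matℤ m n) x t y i → (M · (x +[ t ] y)) i ≡ (M · x) i + t * (M · y) i
·-+[] {n = n} M x t y i = trans (sumℚ-cong n λ j → distrib (ℤ→ℚ (M i j)) (x j) t (y j)) (sumℚ-linear n _ _ t)
  where
  distrib : ∀ a x t y → a * (x + t * y) ≡ a * x + t * (a * y)
  distrib = solve-∀ ℚ-ring

·-scale : ∀ {m n} (M : Matℤ m n) t x i → (M · (λ j → t * x j)) i ≡ t * (M · x) i
·-scale {n = n} M t x i = begin
  sumℚ n (λ j → ℤ→ℚ (M i j) * (t * x j))           ≡⟨ sumℚ-cong n (λ j → shift (ℤ→ℚ (M i j)) t (x j)) ⟩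
  sumℚ n (λ j → 0ℚ + t * (ℤ→ℚ (M i j) * x j))      ≡⟨ sumℚ-linear n (const 0ℚ) _ t ⟩
  sumℚ n (const 0ℚ) + t * (M · x) i                ≡⟨ cong (_+ t * (M · x) i) (sumℚ-zero n λ _ → refl) ⟩
  0ℚ + t * (M · x) i                               ≡⟨ ℚP.+-identityˡ _ ⟩
  t * (M · x) i                                    ∎
  where
  open ≡-Reasoning
  shift : ∀ a t x → a * (t * x) ≡ 0ℚ + t * (a * x)
  shift = solve-∀ ℚ-ring

·-zero : ∀ {m n} (M : Matℤ m n) {x} → x ≗ const 0ℚ → ∀ i → (M · x) i ≡ 0ℚ
·-zero M x≡0 i = sumℚ-zero _ λ j → trans (cong (ℤ→ℚ (M i j) *_) (x≡0 j)) (ℚP.*-zeroʳ (ℤ→ℚ (M i j)))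

·-Integral : ∀ {m n} (M : Matℤ m n) {x} → IsIntegralVec x → ∀ i → Integral ((M · x) i)
·-Integral M x-int i = sumℚ-Integral _ λ j → Integral-* (Integral-ℤ (M i j)) (x-int j)

-- Subsystems selected by a predicate on the rows, and Gaussian elimination

KernelOn : ∀ {K n} → Matℤ K n → (Fin K → Set) → Vecℚ n → Set
KernelOn M S h = ∀ i → S i → (M · h) i ≡ 0ℚ

TrivialKernelOn : ∀ {K n} → Matℤ K n → (Fin K → Set) → Set
TrivialKernelOn M S = ∀ h → KernelOn M S h → ∀ j → h j ≡ 0ℚ

IntegralOn : ∀ {K n} → Matℤ K n → (Fin K → Set) → Vecℚ n → Set
IntegralOn M S x = ∀ i → S i → Integral ((M · x) i)

dropFirstColumn : ∀ {K n} → Matℤ K (suc n) → Matℤ K n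
dropFirstColumn M i l = M i (suc l)

-- Solves row r of M h = 0 for h₀, using (M r 0)⁻¹ = M r 0.
extend : ∀ {K n} → Matℤ (suc K) (suc n) → Fin (suc K) → Vecℚ n → Vecℚ (suc n)
extend M r h zero    = - (ℤ→ℚ (M r zero) * (dropFirstColumn M · h) r)
extend M r h (suc l) = h l

data PunchInView {K} (r : Fin (suc K)) : Fin (suc K) → Set where
  at-pivot : PunchInView r r
  punched  : ∀ s → PunchInView r (punchIn r s)

punchInView : ∀ {K} (r i : Fin (suc K)) → PunchInView r i
punchInView r i with i ≟ r
... | yes refl = at-pivot
... | no i≢r   = subst (PunchInView r) (punchIn-punchOut (i≢r ∘ sym)) (punched _)

module _ {K n} (M : Matℤ (suc K) (suc n)) (r : Fin (suc K)) (unit : IsUnit (M r zero)) where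

  private
    ε = ℤ→ℚ (M r zero)

  ·-pivot : ∀ x s → (pivot M r · tail x) s ≡
    (M · x) (punchIn r s) - ℤ→ℚ (M (punchIn r s) zero) * ε * (M · x) r
  ·-pivot x s = begin
    (pivot M r · tail x) s
      ≡⟨ sumℚ-cong n (λ l → entry (M (punchIn r s) (suc l)) (M r (suc l)) (x (suc l))) ⟩
    sumℚ n (λ l → ℤ→ℚ (M (punchIn r s) (suc l)) * x (suc l) + - (μ * ε) * (ℤ→ℚ (M r (suc l)) * x (suc l)))
      ≡⟨ sumℚ-linear n _ _ (- (μ * ε)) ⟩
    a + - (μ * ε) * b
      ≡⟨ pad a (μ * ε) b (μ * x zero) ⟩
    a + - (μ * ε) * b + μ * x zero * (1ℚ - 1ℚ)
      ≡⟨ cong (λ u → a + - (μ * ε) * b + μ * x zero * (1ℚ - u)) (ℤ→ℚ-unit² unit) ⟨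
    a + - (μ * ε) * b + μ * x zero * (1ℚ - ε * ε)
      ≡⟨ rearrange μ ε (x zero) a b ⟨
    (μ * x zero + a) - μ * ε * (ε * x zero + b) ∎
    where
    open ≡-Reasoning
    μ = ℤ→ℚ (M (punchIn r s) zero)
    a = (dropFirstColumn M · tail x) (punchIn r s)
    b = (dropFirstColumn M · tail x) r
    distrib : ∀ p c q y → (p - c * q) * y ≡ p * y + - c * (q * y)
    distrib = solve-∀ ℚ-ring
    entry : ∀ p q y → ℤ→ℚ (p ℤ.- M (punchIn r s) zero ℤ.* M r zero ℤ.* q) * y ≡ ℤ→ℚ p * y + - (μ * ε) * (ℤ→ℚ q * y)
    entry p q y = begin
      ℤ→ℚ (p ℤ.- m ℤ.* e ℤ.* q) * y                 ≡⟨ cong (_* y) (ℤ→ℚ-+ p (ℤ.- (m ℤ.* e ℤ.* q))) ⟩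
      (ℤ→ℚ p + ℤ→ℚ (ℤ.- (m ℤ.* e ℤ.* q))) * y       ≡⟨ cong (λ u → (ℤ→ℚ p + u) * y) (ℤ→ℚ-neg (m ℤ.* e ℤ.* q)) ⟩
      (ℤ→ℚ p - ℤ→ℚ (m ℤ.* e ℤ.* q)) * y             ≡⟨ cong (λ u → (ℤ→ℚ p - u) * y) (ℤ→ℚ-* (m ℤ.* e) q) ⟩
      (ℤ→ℚ p - ℤ→ℚ (m ℤ.* e) * ℤ→ℚ q) * y           ≡⟨ cong (λ u → (ℤ→ℚ p - u * ℤ→ℚ q) * y) (ℤ→ℚ-* m e) ⟩
      (ℤ→ℚ p - μ * ε * ℤ→ℚ q) * y                   ≡⟨ distrib (ℤ→ℚ p) (μ * ε) (ℤ→ℚ q) y ⟩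
      ℤ→ℚ p * y + - (μ * ε) * (ℤ→ℚ q * y)           ∎
      where
      m = M (punchIn r s) zero
      e = M r zero
    pad : ∀ a c b m → a + - c * b ≡ a + - c * b + m * (1ℚ - 1ℚ)
    pad = solve-∀ ℚ-ring
    rearrange : ∀ μ ε x a b → (μ * x + a) - μ * ε * (ε * x + b) ≡ a + - (μ * ε) * b + μ * x * (1ℚ - ε * ε)
    rearrange = solve-∀ ℚ-ring

  ·-extend : ∀ h → (M · extend M r h) r ≡ 0ℚ
  ·-extend h = let b = (dropFirstColumn M · h) r in begin
    ε * - (ε * b) + b       ≡⟨ factor ε b ⟩
    b * (1ℚ - ε * ε)        ≡⟨ cong (λ u → b * (1ℚ - u)) (ℤ→ℚ-unit² unit) ⟩
    b * (1ℚ - 1ℚ)           ≡⟨ ℚP.*-zeroʳ b ⟩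
    0ℚ                      ∎
    where
    open ≡-Reasoning
    factor : ∀ ε b → ε * - (ε * b) + b ≡ b * (1ℚ - ε * ε)
    factor = solve-∀ ℚ-ring

  head-solved : ∀ x → x zero ≡ ε * ((M · x) r - (dropFirstColumn M · tail x) r)
  head-solved x = let b = (dropFirstColumn M · tail x) r in begin
    x zero                        ≡⟨ ℚP.*-identityˡ (x zero) ⟨
    1ℚ * x zero                   ≡⟨ cong (_* x zero) (ℤ→ℚ-unit² unit) ⟨
    ε * ε * x zero                ≡⟨ cancel ε (x zero) b ⟩
    ε * ((ε * x zero + b) - b)    ∎
    where
    open ≡-Reasoning
    cancel : ∀ ε x b → ε * ε * x ≡ ε * ((ε * x + b) - b)
    cancel = solve-∀ ℚ-ring

  module _ {S : Fin (suc K) → Set} (S-r : S r) where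

    KernelOn-pivot : ∀ {h} → KernelOn M S h → KernelOn (pivot M r) (S ∘ punchIn r) (tail h)
    KernelOn-pivot {h} Mh≡0 s S-s = begin
      (pivot M r · tail h) s                                ≡⟨ ·-pivot h s ⟩
      (M · h) (punchIn r s) - ℤ→ℚ (M (punchIn r s) zero) * ε * (M · h) r
        ≡⟨ cong₂ (λ u v → u - ℤ→ℚ (M (punchIn r s) zero) * ε * v) (Mh≡0 _ S-s) (Mh≡0 r S-r) ⟩
      0ℚ - ℤ→ℚ (M (punchIn r s) zero) * ε * 0ℚ              ≡⟨ vanish (ℤ→ℚ (M (punchIn r s) zero) * ε) ⟩
      0ℚ                                                    ∎
      where
      open ≡-Reasoning
      vanish : ∀ c → 0ℚ - c * 0ℚ ≡ 0ℚ
      vanish = solve-∀ ℚ-ring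

    IntegralOn-pivot : ∀ {x} → IntegralOn M S x → IntegralOn (pivot M r) (S ∘ punchIn r) (tail x)
    IntegralOn-pivot {x} Mx-int s S-s = subst Integral (sym (·-pivot x s))
      (Integral-+ (Mx-int _ S-s) (Integral-neg (Integral-* (Integral-* (Integral-ℤ (M (punchIn r s) zero)) (Integral-ℤ (M r zero))) (Mx-int r S-r))))

  KernelOn-extend : ∀ {S : Fin (suc K) → Set} {h} →
    KernelOn (pivot M r) (S ∘ punchIn r) h → KernelOn M S (extend M r h)
  KernelOn-extend {S} {h} ker i S-i = row i (punchInView r i) S-i
    where
    open ≡-Reasoning
    vanish : ∀ u c → u ≡ u - c * 0ℚ
    vanish = solve-∀ ℚ-ring
    row : ∀ i → PunchInView r i → S i → (M · extend M r h) i ≡ 0ℚ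
    row _ at-pivot    _   = ·-extend h
    row _ (punched s) S-s = begin
      (M · extend M r h) (punchIn r s)
        ≡⟨ vanish _ (ℤ→ℚ (M (punchIn r s) zero) * ε) ⟩
      (M · extend M r h) (punchIn r s) - ℤ→ℚ (M (punchIn r s) zero) * ε * 0ℚ
        ≡⟨ cong (λ u → (M · extend M r h) (punchIn r s) - ℤ→ℚ (M (punchIn r s) zero) * ε * u) (·-extend h) ⟨
      (M · extend M r h) (punchIn r s) - ℤ→ℚ (M (punchIn r s) zero) * ε * (M · extend M r h) r
        ≡⟨ ·-pivot (extend M r h) s ⟨
      (pivot M r · h) s
        ≡⟨ ker s S-s ⟩
      0ℚ ∎

NontrivialKernelOn : ∀ {K n} → Matℤ K n → (Fin K → Set) → Set
NontrivialKernelOn M S = ∃ λ h → KernelOn M S h × NonZeroVec h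

nonzero-TUValue-isUnit : ∀ {e} → IsTUValue e → e ≢ 0ℤ → IsUnit e
nonzero-TUValue-isUnit (inj₁ e≡0)  e≢0 = ⊥-elim (e≢0 e≡0)
nonzero-TUValue-isUnit (inj₂ e≡±1) _   = e≡±1

-- Gaussian elimination with ±1 pivots, which keep the system totally unimodular.
kernel-alternative : ∀ {K n} (M : Matℤ K n) {S : Fin K → Set} → Decidable S → TotallyUnimodular M →
  NontrivialKernelOn M S ⊎ (TrivialKernelOn M S × (∀ x → IntegralOn M S x → IsIntegralVec x))
kernel-alternative {n = zero}  M S? tu = inj₂ ((λ _ _ ()) , (λ _ _ ()))
kernel-alternative {n = suc n} M {S} S? tu with any? (λ r → S? r ×-dec ¬? (M r zero ℤ.≟ 0ℤ))
... | yes (r , S-r , M-r≢0) = eliminate M S? tu r S-r (nonzero-TUValue-isUnit (TU-entry M tu r zero) M-r≢0)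
  where
  eliminate : ∀ {K} (M : Matℤ K (suc n)) {S : Fin K → Set} → Decidable S → TotallyUnimodular M →
    ∀ r → S r → IsUnit (M r zero) →
    NontrivialKernelOn M S ⊎ (TrivialKernelOn M S × (∀ x → IntegralOn M S x → IsIntegralVec x))
  eliminate {suc K} M {S} S? tu r S-r unit with kernel-alternative (pivot M r) (S? ∘ punchIn r) (pivot-TU M r tu unit)
  ... | inj₁ (h , ker , h≢0)     = inj₁ (extend M r h , KernelOn-extend M r unit ker , λ h′≡0 → h≢0 (h′≡0 ∘ suc))
  ... | inj₂ (trivial , integral) = inj₂ (trivial′ , integral′)
    where
    tail≡0 : ∀ h → KernelOn M S h → ∀ l → h (suc l) ≡ 0ℚ
    tail≡0 h ker = trivial (tail h) (KernelOn-pivot M r unit S-r {h} ker)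
    tail-integral : ∀ x → IntegralOn M S x → ∀ l → Integral (x (suc l))
    tail-integral x Mx-int = integral (tail x) (IntegralOn-pivot M r unit S-r {x} Mx-int)
    trivial′ : TrivialKernelOn M S
    trivial′ h ker zero    = trans (head-solved M r unit h) (trans (cong₂ (λ u v → ℤ→ℚ (M r zero) * (u - v))
      (ker r S-r) (·-zero (dropFirstColumn M) (tail≡0 h ker) r)) (ℚP.*-zeroʳ (ℤ→ℚ (M r zero))))
    trivial′ h ker (suc l) = tail≡0 h ker l
    integral′ : ∀ x → IntegralOn M S x → IsIntegralVec x
    integral′ x Mx-int zero    = subst Integral (sym (head-solved M r unit x)) (Integral-* (Integral-ℤ (M r zero))
      (Integral-+ (Mx-int r S-r) (Integral-neg (·-Integral (dropFirstColumn M) (tail-integral x Mx-int) r))))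
    integral′ x Mx-int (suc l) = tail-integral x Mx-int l
... | no no-pivot = inj₁ (e₀ , e₀-kernel , λ e₀≡0 → 1≢0 (e₀≡0 zero))
  where
  e₀ : Vecℚ (suc n)
  e₀ = 1ℚ ∷ const 0ℚ
  1≢0 : 1ℚ ≢ 0ℚ
  1≢0 ()
  e₀-kernel : KernelOn M S e₀
  e₀-kernel i S-i = cong₂ _+_
    (cong (λ z → ℤ→ℚ z * 1ℚ) (decidable-stable (M i zero ℤ.≟ 0ℤ) λ M-i≢0 → no-pivot (i , S-i , M-i≢0)))
    (·-zero (dropFirstColumn M) (λ _ → refl) i)

≤∧≢⇒< : ∀ {a b : ℚ} → a ≤ b → a ≢ b → a < b
≤∧≢⇒< {a} {b} a≤b a≢b with a ℚP.<? b
... | yes a<b = a<b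
... | no  a≮b = ⊥-elim (a≢b (ℚP.≤-antisym a≤b (ℚP.≮⇒≥ a≮b)))

-- a ÷ b for positive b; the positivity proof only feeds an irrelevant instance
_÷⁺_∣_ : ℚ → (b : ℚ) → .(0ℚ < b) → ℚ
a ÷⁺ b ∣ b>0 = (a ÷ b) {{ℚP.pos⇒nonZero b {{ℚ.positive b>0}}}}

÷⁺-*-cancel : ∀ a {b} .(b>0 : 0ℚ < b) → (a ÷⁺ b ∣ b>0) * b ≡ a
÷⁺-*-cancel a {b} b>0 = trans (ℚP.*-assoc a _ b)
  (trans (cong (a *_) (ℚP.*-inverseˡ b {{ℚP.pos⇒nonZero b {{ℚ.positive b>0}}}})) (ℚP.*-identityʳ a))

≤÷⁺⇒*≤ : ∀ {μ a b} (b>0 : 0ℚ < b) → μ ≤ (a ÷⁺ b ∣ b>0) → μ * b ≤ a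
≤÷⁺⇒*≤ {μ} {a} {b} b>0 μ≤ = subst (μ * b ≤_) (÷⁺-*-cancel a b>0)
  (ℚP.*-monoʳ-≤-nonNeg b {{ℚ.nonNegative (ℚP.<⇒≤ b>0)}} μ≤)

÷⁺-nonNeg : ∀ {a b} → 0ℚ ≤ a → (b>0 : 0ℚ < b) → 0ℚ ≤ (a ÷⁺ b ∣ b>0)
÷⁺-nonNeg {a} {b} a≥0 b>0 = ℚP.≮⇒≥ λ ratio<0 → ℚP.<-irrefl refl (ℚP.<-≤-trans
  (subst₂ _<_ (÷⁺-*-cancel a b>0) (ℚP.*-zeroˡ b) (ℚP.*-monoˡ-<-pos b {{ℚ.positive b>0}} ratio<0)) a≥0)

x+t*0≡x : ∀ x t → x + t * 0ℚ ≡ x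
x+t*0≡x = solve-∀ ℚ-ring

convex-tight : ∀ {a b c λ′ : ℚ} → a ≤ c → b ≤ c → 0ℚ < λ′ → λ′ < 1ℚ →
  λ′ * a + (1ℚ - λ′) * b ≡ c → a ≡ c × b ≡ c
convex-tight {a} {b} {c} {λ′} a≤c b≤c λ′>0 λ′<1 comb =
  first a≤c b≤c λ′>0 (1-λ>0 λ′<1) comb ,
  first b≤c a≤c (1-λ>0 λ′<1) (subst (0ℚ <_) (sym (1-[1-λ] λ′)) λ′>0) (trans (swap b a λ′) comb)
  where
  split : ∀ c t → c ≡ t * c + (1ℚ - t) * c
  split = solve-∀ ℚ-ring
  1-[1-λ] : ∀ t → 1ℚ - (1ℚ - t) ≡ t
  1-[1-λ] = solve-∀ ℚ-ring
  swap : ∀ b a t → (1ℚ - t) * b + (1ℚ - (1ℚ - t)) * a ≡ t * a + (1ℚ - t) * b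
  swap = solve-∀ ℚ-ring
  1-λ>0 : ∀ {t} → t < 1ℚ → 0ℚ < 1ℚ - t
  1-λ>0 {t} t<1 = subst (_< 1ℚ - t) (ℚP.+-inverseʳ t) (ℚP.+-monoˡ-< (- t) t<1)
  first : ∀ {a b t} → a ≤ c → b ≤ c → 0ℚ < t → 0ℚ < 1ℚ - t → t * a + (1ℚ - t) * b ≡ c → a ≡ c
  first {a} {b} {t} a≤c b≤c t>0 1-t>0 comb with a ℚP.≟ c
  ... | yes a≡c = a≡c
  ... | no  a≢c = ⊥-elim (ℚP.<-irrefl (trans comb (split c t))
    (ℚP.+-mono-<-≤ (ℚP.*-monoʳ-<-pos t {{ℚ.positive t>0}} (≤∧≢⇒< a≤c a≢c))
                   (ℚP.*-monoˡ-≤-nonNeg (1ℚ - t) {{ℚ.nonNegative (ℚP.<⇒≤ 1-t>0)}} b≤c)))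

argmin : ∀ {k} {P : Fin k → Set} → Decidable P → (f : ∀ i → .(P i) → ℚ) →
  (∀ i → ¬ P i) ⊎ Σ (Fin k) λ i₀ → Σ (P i₀) λ P-i₀ → ∀ i (P-i : P i) → f i₀ P-i₀ ≤ f i P-i
argmin {zero}  P? f = inj₁ λ ()
argmin {suc k} P? f with argmin (P? ∘ suc) (f ∘ suc) | P? zero
... | inj₁ none | no ¬P₀ = inj₁ λ { zero → ¬P₀ ; (suc i) → none i }
... | inj₁ none | yes P₀ = inj₂ (zero , P₀ , λ { zero _ → ℚP.≤-refl ; (suc i) P-i → ⊥-elim (none i P-i) })
... | inj₂ (i₀ , P-i₀ , min) | no ¬P₀ =
  inj₂ (suc i₀ , P-i₀ , λ { zero P₀ → ⊥-elim (¬P₀ P₀) ; (suc i) P-i → min i P-i })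
... | inj₂ (i₀ , P-i₀ , min) | yes P₀ with f zero P₀ ℚP.≤? f (suc i₀) P-i₀
...   | yes f₀≤ = inj₂ (zero , P₀ , λ { zero _ → ℚP.≤-refl ; (suc i) P-i → ℚP.≤-trans f₀≤ (min i P-i) })
...   | no  f₀≰ = inj₂ (suc i₀ , P-i₀ , λ { zero _ → ℚP.<⇒≤ (ℚP.≰⇒> f₀≰) ; (suc i) P-i → min i P-i })

-- Polyhedra

module _ {m p n} (A : Matℤ m n) (b : Vecℚ m) (B : Matℤ p n) (d : Vecℚ p) where

  private
    P : Vecℚ n → Set
    P = InP A b B d

  Tight : Vecℚ n → Fin p → Set
  Tight z i = (B · z) i ≡ d i

  tight? : ∀ z → Decidable (Tight z)
  tight? z i = (B · z) i ℚP.≟ d i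

  FaceDirection : Vecℚ n → Vecℚ n → Set
  FaceDirection z h = InKer A h × (∀ i → Tight z i → (B · h) i ≡ 0ℚ)

  P-cong : ∀ {x y} → x ≗ y → P x → P y
  P-cong x≗y (Ax≡b , Bx≤d) =
    (λ i → trans (sym (·-cong A x≗y i)) (Ax≡b i)) , (λ i → subst (_≤ d i) (·-cong B x≗y i) (Bx≤d i))

  P-+[] : ∀ {x h} t → P x → InKer A h → (∀ i → (B · x) i + t * (B · h) i ≤ d i) → P (x +[ t ] h)
  P-+[] {x} {h} t (Ax≡b , _) Ah≡0 bound =
    (λ i → trans (·-+[] A x t h i) (trans (cong₂ (λ u v → u + t * v) (Ax≡b i) (Ah≡0 i)) (x+t*0≡x (b i) t))) ,
    (λ i → subst (_≤ d i) (sym (·-+[] B x t h i)) (bound i))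

  non-ascending-bound : ∀ {x h t i} → P x → 0ℚ ≤ t → (B · h) i ≤ 0ℚ → (B · x) i + t * (B · h) i ≤ d i
  non-ascending-bound {x} {h} {t} {i} x∈P t≥0 slope≤0 = ℚP.≤-trans
    (subst ((B · x) i + t * (B · h) i ≤_) (x+t*0≡x ((B · x) i) t) (ℚP.+-monoʳ-≤ ((B · x) i)
      (ℚP.*-monoˡ-≤-nonNeg t {{ℚ.nonNegative t≥0}} slope≤0)))
    (proj₂ x∈P i)

  +[]-+[] : ∀ (x h : Vecℚ n) s t → (x +[ s ] h) +[ t ] h ≗ x +[ s + t ] h
  +[]-+[] x h s t j = assoc (x j) (h j) s t
    where
    assoc : ∀ x h s t → x + s * h + t * h ≡ x + (s + t) * h
    assoc = solve-∀ ℚ-ring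

  ratio-test : ∀ {x h i₁} → P x → InKer A h → 0ℚ < (B · h) i₁ →
    Σ ℚ λ μ → Σ (Fin p) λ i₀ → 0ℚ ≤ μ × 0ℚ < (B · h) i₀ × P (x +[ μ ] h) × Tight (x +[ μ ] h) i₀
  ratio-test {x} {h} {i₁} x∈P Ah≡0 slope₁>0 with argmin (λ i → 0ℚ ℚP.<? (B · h) i) ratio
    where
    ratio : ∀ i → .(0ℚ < (B · h) i) → ℚ
    ratio i slope>0 = (d i - (B · x) i) ÷⁺ (B · h) i ∣ slope>0
  ... | inj₁ none = ⊥-elim (none i₁ slope₁>0)
  ... | inj₂ (i₀ , slope₀>0 , min) = μ , i₀ , μ≥0 , slope₀>0 , P-+[] μ x∈P Ah≡0 bound , tight₀
    where
    slack : ∀ i → (B · x) i + (d i - (B · x) i) ≡ d i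
    slack i = refill ((B · x) i) (d i)
      where
      refill : ∀ u v → u + (v - u) ≡ v
      refill = solve-∀ ℚ-ring
    slack≥0 : ∀ i → 0ℚ ≤ d i - (B · x) i
    slack≥0 i = subst (_≤ d i - (B · x) i) (ℚP.+-inverseʳ ((B · x) i)) (ℚP.+-monoˡ-≤ (- (B · x) i) (proj₂ x∈P i))
    μ = (d i₀ - (B · x) i₀) ÷⁺ (B · h) i₀ ∣ slope₀>0
    μ≥0 : 0ℚ ≤ μ
    μ≥0 = ÷⁺-nonNeg (slack≥0 i₀) slope₀>0
    bound : ∀ i → (B · x) i + μ * (B · h) i ≤ d i
    bound i with 0ℚ ℚP.<? (B · h) i
    ... | yes slope>0 = subst ((B · x) i + μ * (B · h) i ≤_) (slack i)
                          (ℚP.+-monoʳ-≤ ((B · x) i) (≤÷⁺⇒*≤ slope>0 (min i slope>0)))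
    ... | no  slope≯0 = non-ascending-bound x∈P μ≥0 (ℚP.≮⇒≥ slope≯0)
    tight₀ : Tight (x +[ μ ] h) i₀
    tight₀ = trans (·-+[] B x μ h i₀) (trans (cong ((B · x) i₀ +_) (÷⁺-*-cancel _ slope₀>0)) (slack i₀))

  no-step-beyond : ∀ {y h α} → (∀ β → α < β → ¬ P (y +[ β ] h)) → ∀ {t} → 0ℚ < t → ¬ P ((y +[ α ] h) +[ t ] h)
  no-step-beyond {y} {h} {α} maximal {t} t>0 y″∈P =
    maximal (α + t) (subst (_< α + t) (ℚP.+-identityʳ α) (ℚP.+-monoʳ-< α t>0)) (P-cong (+[]-+[] y h α t) y″∈P)

  maximal-step-tight : ∀ {y h α} → InKer A h → P (y +[ α ] h) →
    (∀ β → α < β → ¬ P (y +[ β ] h)) → ∃ λ i₀ → 0ℚ < (B · h) i₀ × Tight (y +[ α ] h) i₀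
  maximal-step-tight {y} {h} {α} Ah≡0 y′∈P maximal with any? (λ i → 0ℚ ℚP.<? (B · h) i)
  ... | no no-ascent = ⊥-elim (no-step-beyond {y} {h} {α} maximal (ℚP.positive⁻¹ 1ℚ)
        (P-+[] 1ℚ y′∈P Ah≡0 λ i → non-ascending-bound y′∈P (ℚP.<⇒≤ (ℚP.positive⁻¹ 1ℚ)) (ℚP.≮⇒≥ (no-ascent ∘ (i ,_)))))
  ... | yes (i₁ , slope₁>0) with ratio-test y′∈P Ah≡0 slope₁>0
  ...   | μ , i₀ , μ≥0 , slope₀>0 , y″∈P , tight₀ with μ ℚP.≟ 0ℚ
  ...     | yes refl = i₀ , slope₀>0 , trans (·-cong B (λ j → sym (stay (y j) (h j) α)) i₀) tight₀
    where
    stay : ∀ y h α → y + α * h + 0ℚ * h ≡ y + α * h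
    stay = solve-∀ ℚ-ring
  ...     | no  μ≢0 = ⊥-elim (no-step-beyond {y} {h} {α} maximal (≤∧≢⇒< μ≥0 (μ≢0 ∘ sym)) y″∈P)

  vertex⇒pointed : ∀ {v h} → IsVertex A b B d v → InKer A h → (∀ i → (B · h) i ≡ 0ℚ) → ∀ j → h j ≡ 0ℚ
  vertex⇒pointed {v} {h} (v∈P , extreme) Ah≡0 Bh≡0 j = begin
    h j                                             ≡⟨ halve (v j) (h j) ⟩
    ½ * ((v j + 1ℚ * h j) - (v j + - 1ℚ * h j))     ≡⟨ cong (λ u → ½ * (u - (v j + - 1ℚ * h j))) v+h≡v-h ⟩
    ½ * ((v j + - 1ℚ * h j) - (v j + - 1ℚ * h j))   ≡⟨ cancel (v j + - 1ℚ * h j) ⟩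
    0ℚ                                              ∎
    where
    open ≡-Reasoning
    halve : ∀ v h → h ≡ ½ * ((v + 1ℚ * h) - (v + - 1ℚ * h))
    halve = solve-∀ ℚ-ring
    cancel : ∀ u → ½ * (u - u) ≡ 0ℚ
    cancel = solve-∀ ℚ-ring
    average : ∀ v h → v ≡ ½ * (v + 1ℚ * h) + (1ℚ - ½) * (v + - 1ℚ * h)
    average = solve-∀ ℚ-ring
    move : ∀ t → P (v +[ t ] h)
    move t = P-+[] t v∈P Ah≡0 λ i →
      subst (_≤ d i) (sym (trans (cong (λ u → (B · v) i + t * u) (Bh≡0 i)) (x+t*0≡x _ t))) (proj₂ v∈P i)
    v+h≡v-h : v j + 1ℚ * h j ≡ v j + - 1ℚ * h j
    v+h≡v-h = extreme _ _ ½ (move 1ℚ) (move (- 1ℚ)) (ℚP.positive⁻¹ ½) (toWitness {a? = ½ ℚP.<? 1ℚ} tt)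
      (λ j → average (v j) (h j)) j

  trivial-face⇒vertex : ∀ {z} → P z → (∀ h → FaceDirection z h → ∀ j → h j ≡ 0ℚ) → IsVertex A b B d z
  trivial-face⇒vertex {z} z∈P trivial = z∈P , λ y w λ′ y∈P w∈P λ′>0 λ′<1 z≡comb j →
    trans (split (y j) (w j)) (trans (cong (_+ w j) (trivial (y +[ - 1ℚ ] w) (A-diff y∈P w∈P , B-diff y∈P w∈P λ′>0 λ′<1 z≡comb) j))
      (ℚP.+-identityˡ (w j)))
    where
    split : ∀ y w → y ≡ (y + - 1ℚ * w) + w
    split = solve-∀ ℚ-ring
    cancel : ∀ u → u + - 1ℚ * u ≡ 0ℚ
    cancel = solve-∀ ℚ-ring
    A-diff : ∀ {y w} → P y → P w → InKer A (y +[ - 1ℚ ] w)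
    A-diff {y} {w} y∈P w∈P i = trans (·-+[] A y (- 1ℚ) w i)
      (trans (cong₂ (λ u v → u + - 1ℚ * v) (proj₁ y∈P i) (proj₁ w∈P i)) (cancel (b i)))
    B-diff : ∀ {y w λ′} → P y → P w → 0ℚ < λ′ → λ′ < 1ℚ → (∀ j → z j ≡ λ′ * y j + (1ℚ - λ′) * w j) →
      ∀ i → Tight z i → (B · (y +[ - 1ℚ ] w)) i ≡ 0ℚ
    B-diff {y} {w} {λ′} y∈P w∈P λ′>0 λ′<1 z≡comb i tight = begin
      (B · (y +[ - 1ℚ ] w)) i         ≡⟨ ·-+[] B y (- 1ℚ) w i ⟩
      (B · y) i + - 1ℚ * (B · w) i    ≡⟨ cong₂ (λ u v → u + - 1ℚ * v) By≡d Bw≡d ⟩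
      d i + - 1ℚ * d i                ≡⟨ cancel (d i) ⟩
      0ℚ                              ∎
      where
      open ≡-Reasoning
      comb : λ′ * (B · y) i + (1ℚ - λ′) * (B · w) i ≡ d i
      comb = begin
        λ′ * (B · y) i + (1ℚ - λ′) * (B · w) i                   ≡⟨ cong (_+ (1ℚ - λ′) * (B · w) i) (·-scale B λ′ y i) ⟨
        (B · (λ j → λ′ * y j)) i + (1ℚ - λ′) * (B · w) i         ≡⟨ ·-+[] B (λ j → λ′ * y j) (1ℚ - λ′) w i ⟨
        (B · ((λ j → λ′ * y j) +[ 1ℚ - λ′ ] w)) i                ≡⟨ ·-cong B z≡comb i ⟨
        (B · z) i                                                ≡⟨ tight ⟩
        d i                                                      ∎
      By≡d = proj₁ (convex-tight (proj₂ y∈P i) (proj₂ w∈P i) λ′>0 λ′<1 comb)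
      Bw≡d = proj₂ (convex-tight (proj₂ y∈P i) (proj₂ w∈P i) λ′>0 λ′<1 comb)

  Rows : (Fin p → Set) → Fin (m ℕ.+ p) → Set
  Rows T k = [ const ⊤ , T ]′ (splitAt m k)

  Rows? : ∀ {T} → Decidable T → Decidable (Rows T)
  Rows? T? k with splitAt m k
  ... | inj₁ _ = yes tt
  ... | inj₂ i = T? i

  ·-stack : ∀ x k → (stack A B · x) k ≡ [ A · x , B · x ]′ (splitAt m k)
  ·-stack x k with splitAt m k
  ... | inj₁ i = refl
  ... | inj₂ i = refl

  KernelOn-stack⁺ : ∀ {T h} → InKer A h → (∀ i → T i → (B · h) i ≡ 0ℚ) → KernelOn (stack A B) (Rows T) h
  KernelOn-stack⁺ {T} {h} Ah≡0 Bh≡0 k row with splitAt m k | ·-stack h k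
  ... | inj₁ i | eq = trans eq (Ah≡0 i)
  ... | inj₂ i | eq = trans eq (Bh≡0 i row)

  KernelOn-stack⁻ : ∀ {T h} → KernelOn (stack A B) (Rows T) h → InKer A h × (∀ i → T i → (B · h) i ≡ 0ℚ)
  KernelOn-stack⁻ {T} {h} ker =
    (λ i → trans (sym (trans (·-stack h (i ↑ˡ p)) (cong [ A · h , B · h ]′ (splitAt-↑ˡ m i p))))
                 (ker (i ↑ˡ p) (subst [ const ⊤ , T ]′ (sym (splitAt-↑ˡ m i p)) tt))) ,
    (λ i T-i → trans (sym (trans (·-stack h (m ↑ʳ i)) (cong [ A · h , B · h ]′ (splitAt-↑ʳ m p i))))
                     (ker (m ↑ʳ i) (subst [ const ⊤ , T ]′ (sym (splitAt-↑ʳ m p i)) T-i)))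

  IntegralOn-stack : ∀ {T x} → (∀ i → Integral ((A · x) i)) → (∀ i → T i → Integral ((B · x) i)) →
    IntegralOn (stack A B) (Rows T) x
  IntegralOn-stack {T} {x} A-int B-int k row with splitAt m k | ·-stack x k
  ... | inj₁ i | eq = subst Integral (sym eq) (A-int i)
  ... | inj₂ i | eq = subst Integral (sym eq) (B-int i row)

  tightSet : Vecℚ n → Subset p
  tightSet z = tabulate (does ∘ tight? z)

  ∈-tightSet⁺ : ∀ {z i} → Tight z i → i ∈ tightSet z
  ∈-tightSet⁺ {z} {i} tight =
    lookup⇒[]= i (tightSet z) (trans (lookup∘tabulate (does ∘ tight? z) i) (dec-true (tight? z i) tight))

  ∈-tightSet⁻ : ∀ {z i} → i ∈ tightSet z → Tight z i
  ∈-tightSet⁻ {z} {i} i∈ with tight? z i | trans (sym ([]=⇒lookup i∈)) (lookup∘tabulate (does ∘ tight? z) i)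
  ... | yes tight | _  = tight
  ... | no  _     | ()

  ascending-direction : ∀ {z h i₁} → FaceDirection z h → (B · h) i₁ ≢ 0ℚ →
    ∃ λ h′ → FaceDirection z h′ × 0ℚ < (B · h′) i₁
  ascending-direction {z} {h} {i₁} (Ah≡0 , Bh≡0) slope≢0 with 0ℚ ℚP.<? (B · h) i₁
  ... | yes slope>0 = h , (Ah≡0 , Bh≡0) , slope>0
  ... | no  slope≯0 = (λ j → - 1ℚ * h j) ,
    ((λ i → trans (·-scale A (- 1ℚ) h i) (cong (- 1ℚ *_) (Ah≡0 i))) ,
     (λ i t → trans (·-scale B (- 1ℚ) h i) (cong (- 1ℚ *_) (Bh≡0 i t)))) ,
    subst (0ℚ <_) (sym (trans (·-scale B (- 1ℚ) h i₁) (-1*x≡-x ((B · h) i₁))))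
      (ℚP.neg-antimono-< (≤∧≢⇒< (ℚP.≮⇒≥ slope≯0) slope≢0))
    where
    -1*x≡-x : ∀ x → - 1ℚ * x ≡ - x
    -1*x≡-x = solve-∀ ℚ-ring

  leave-face : ∀ {v z h} → IsVertex A b B d v → P z → FaceDirection z h → NonZeroVec h →
    ∃ λ z′ → P z′ × (∀ i → Tight z i → Tight z′ i) × ∃ λ i₀ → Tight z′ i₀ × ¬ Tight z i₀
  leave-face {v} {z} {h} v-vertex z∈P face h≢0 with all? (λ i → (B · h) i ℚP.≟ 0ℚ)
  ... | yes Bh≡0 = ⊥-elim (h≢0 (vertex⇒pointed v-vertex (proj₁ face) Bh≡0))
  ... | no  Bh≢0 with ¬∀⟶∃¬ p _ (λ i → (B · h) i ℚP.≟ 0ℚ) Bh≢0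
  ...   | i₁ , slope₁≢0 with ascending-direction face slope₁≢0
  ...     | h′ , (Ah′≡0 , Bh′≡0) , slope₁>0 with ratio-test z∈P Ah′≡0 slope₁>0
  ...       | μ , i₀ , _ , slope₀>0 , z′∈P , tight₀ =
    z +[ μ ] h′ , z′∈P , stays-tight , i₀ , tight₀ , λ tight → ℚP.<⇒≢ slope₀>0 (sym (Bh′≡0 i₀ tight))
    where
    stays-tight : ∀ i → Tight z i → Tight (z +[ μ ] h′) i
    stays-tight i tight = trans (·-+[] B z μ h′ i)
      (trans (cong₂ (λ u v → u + μ * v) tight (Bh′≡0 i tight)) (x+t*0≡x (d i) μ))

  -- Well-founded induction on the set of tight constraints, which grows strictly along leave-face.
  vertex-in-face : TotallyUnimodular (stack A B) → ∀ {v z} → IsVertex A b B d v → P z →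
    ∃ λ w → IsVertex A b B d w × (∀ i → Tight z i → Tight w i)
  vertex-in-face tu {v} {z} v-vertex z∈P = go z∈P (⊃-wellFounded (tightSet z))
    where
    go : ∀ {z} → P z → Acc _⊃_ (tightSet z) → ∃ λ w → IsVertex A b B d w × (∀ i → Tight z i → Tight w i)
    go {z} z∈P (acc larger) with kernel-alternative (stack A B) (Rows? (tight? z)) tu
    ... | inj₂ (trivial , _) =
      z , trivial-face⇒vertex z∈P (λ h (Ah≡0 , Bh≡0) → trivial h (KernelOn-stack⁺ Ah≡0 Bh≡0)) , λ _ tight → tight
    ... | inj₁ (h , ker , h≢0) with leave-face v-vertex z∈P (KernelOn-stack⁻ ker) h≢0
    ...   | z′ , z′∈P , z⊆z′ , i₀ , tight₀ , ¬tight₀ with go z′∈P (larger (grows , i₀ , ∈-tightSet⁺ tight₀ , ¬tight₀ ∘ ∈-tightSet⁻))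
      where
      grows : tightSet z ⊆ tightSet z′
      grows i∈ = ∈-tightSet⁺ (z⊆z′ _ (∈-tightSet⁻ i∈))
    ...     | w , w-vertex , z′⊆w = w , w-vertex , λ i → z′⊆w i ∘ z⊆z′ i

  tight-rhs-integral : TotallyUnimodular (stack A B) → IntegralPolyhedron A b B d → ∀ {v z i} →
    IsVertex A b B d v → P z → Tight z i → Integral (d i)
  tight-rhs-integral tu ip v-vertex z∈P tight with vertex-in-face tu v-vertex z∈P
  ... | w , w-vertex , z⊆w = subst Integral (z⊆w _ tight) (·-Integral B (ip w w-vertex) _)

  CircuitRows : Vecℤ n → Fin p → Fin p → Set
  CircuitRows g i₀ i = (B · toℚ g) i ≡ 0ℚ ⊎ i ≡ i₀

  circuitRows? : ∀ g i₀ → Decidable (CircuitRows g i₀)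
  circuitRows? g i₀ i = ((B · toℚ g) i ℚP.≟ 0ℚ) ⊎-dec (i ≟ i₀)

  -- A kernel vector of these rows has support of Bh inside that of Bg but misses i₀, contradicting minimality.
  CircuitRows-rigid : ∀ {g i₀} → IsCircuit A B g → (B · toℚ g) i₀ ≢ 0ℚ →
    ¬ NontrivialKernelOn (stack A B) (Rows (CircuitRows g i₀))
  CircuitRows-rigid {g} {i₀} (_ , _ , _ , minimal) slope₀≢0 (h , ker , h≢0) =
    minimal h Ah≡0 h≢0 (λ i Bh≢0 Bg≡0 → Bh≢0 (Bh≡0 i (inj₁ Bg≡0))) i₀ slope₀≢0 (Bh≡0 i₀ (inj₂ refl))
    where
    Ah≡0 = proj₁ (KernelOn-stack⁻ ker)
    Bh≡0 = proj₂ (KernelOn-stack⁻ ker)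

  circuit-step-integral : TotallyUnimodular (stack A B) → IntegralPolyhedron A b B d → ∀ {v y g α} →
    IsVertex A b B d v → IsIntegralVec y → P y → P (y +[ α ] toℚ g) → IsCircuit A B g →
    (∀ β → α < β → ¬ P (y +[ β ] toℚ g)) → IsIntegralVec (y +[ α ] toℚ g)
  circuit-step-integral tu ip {v} {y} {g} {α} v-vertex y-int y∈P y′∈P circuit maximal
    with maximal-step-tight {y} {toℚ g} {α} (proj₁ circuit) y′∈P maximal
  ... | i₀ , slope₀>0 , tight₀ with kernel-alternative (stack A B) (Rows? (circuitRows? g i₀)) tu
  ...   | inj₁ nontrivial     = ⊥-elim (CircuitRows-rigid {g} {i₀} circuit (ℚP.<⇒≢ slope₀>0 ∘ sym) nontrivial)
  ...   | inj₂ (_ , integral) = integral (y +[ α ] toℚ g) (IntegralOn-stack A-int rows-int)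
    where
    A-int : ∀ i → Integral ((A · (y +[ α ] toℚ g)) i)
    A-int i = subst Integral (trans (proj₁ y∈P i) (sym (proj₁ y′∈P i))) (·-Integral A y-int i)
    rows-int : ∀ i → CircuitRows g i₀ i → Integral ((B · (y +[ α ] toℚ g)) i)
    rows-int i (inj₁ flat) = subst Integral (sym (trans (·-+[] B y α (toℚ g) i)
      (trans (cong (λ u → (B · y) i + α * u) flat) (x+t*0≡x _ α)))) (·-Integral B y-int i)
    rows-int _ (inj₂ refl) = subst Integral (sym tight₀) (tight-rhs-integral tu ip v-vertex y′∈P tight₀)

CircuitWalk-in-P : ∀ {m p n} {A : Matℤ m n} {b : Vecℚ m} {B : Matℤ p n} {d : Vecℚ p} {v₁ v₂ : Vecℚ n} →
  IsVertex A b B d v₂ → (W : CircuitWalk A b B d v₁ v₂) → ∀ j → InP A b B d (CircuitWalk.y W j)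
CircuitWalk-in-P {A = A} {b} {B} {d} v₂-vertex W j = in-P (len ℕ.≟ toℕ j)
  where
  open CircuitWalk W
  in-P : Dec (len ≡ toℕ j) → InP A b B d (y j)
  in-P (yes len≡j) = subst (InP A b B d)
    (sym (trans (cong y (toℕ-injective (trans (sym len≡j) (sym (toℕ-fromℕ len))))) end)) (proj₁ v₂-vertex)
  in-P (no len≢j) = subst (InP A b B d) (cong y (inject₁-lower₁ j len≢j)) (inP (lower₁ j len≢j))

theorem3 : ∀ (m p n : ℕ) (A : Matℤ m n) (b : Vecℚ m) (B : Matℤ p n) (d : Vecℚ p) →
    TotallyUnimodular (stack A B) →
    IntegralPolyhedron A b B d →
    ∀ (v₁ v₂ : Vecℚ n) → IsVertex A b B d v₁ → IsVertex A b B d v₂ →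
    (W : CircuitWalk A b B d v₁ v₂) → IntegralWalk W
theorem3 m p n A b B d tu ip v₁ v₂ v₁-vertex v₂-vertex W = <-weakInduction (IsIntegralVec ∘ y) y₀-integral advance
  where
  open CircuitWalk W
  y₀-integral : IsIntegralVec (y zero)
  y₀-integral = subst IsIntegralVec (sym start) (ip v₁ v₁-vertex)
  advance : ∀ i → IsIntegralVec (y (inject₁ i)) → IsIntegralVec (y (suc i))
  advance i y-int = subst IsIntegralVec (sym (step i))
    (circuit-step-integral A b B d tu ip {g = g i} v₁-vertex y-int (inP i)
      (subst (InP A b B d) (step i) (CircuitWalk-in-P v₂-vertex W (suc i))) (circuit i) (maximal i))
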